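{- Let $k\ge 2$ be an integer and let $M_1$ and $N$ be matroids such that $M_1$ has a minor isomorphic to $kN$. Then every elementary lift $M_2$ of $M_1$ has a minor isomorphic to $(k-1)N$.
   Context: $kN$ denotes the direct sum (disjoint union) of $k$ copies of $N$. A matroid $M_2$ is an elementary lift of $M_1$ if there is a matroid $M$ with an element $e$ such that $M_1=M/e$ and $M_2=M\setminus e$. -}

module Defs where

open import Data.Nat using (ℕ; suc; _<_)
open import Data.Fin using (Fin; combine; punchIn; _≟_)
open import Data.Fin.Subset using (Subset; ⊥; ⁅_⁆; _∪_; _⊆_; _∈_; _∉_; ∣_∣)
open import Data.Fin.Subset.Properties using (_∈?_)
open import Data.Fin.Properties using (any?)
open import Data.Vec using (tabulate; lookup)
open import Data.Product using (Σ; ∃; _×_; _,_)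
open import Relation.Nullary using (¬_; Dec)
open import Relation.Nullary.Decidable using (⌊_⌋; _×-dec_)
open import Relation.Unary using (Decidable)
open import Relation.Binary.PropositionalEquality using (_≡_)
open import Function using (_⇔_)
open import Function.Definitions using (Injective)

record Matroid (n : ℕ) : Set₁ where
  field
    Indep     : Subset n → Set
    Indep?    : Decidable Indep
    indep-∅   : Indep ⊥
    indep-⊆   : ∀ {X Y} → X ⊆ Y → Indep Y → Indep X
    indep-aug : ∀ {X Y} → Indep X → Indep Y → ∣ X ∣ < ∣ Y ∣ →
                ∃ λ e → e ∈ Y × e ∉ X × Indep (⁅ e ⁆ ∪ X)

open Matroid public

image : ∀ {m n} → (Fin m → Fin n) → Subset m → Subset n
image φ X = tabulate (λ y → ⌊ any? (λ x → (x ∈? X) ×-dec (φ x ≟ y)) ⌋)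

IsBasisOf : ∀ {n} → Matroid n → Subset n → Subset n → Set
IsBasisOf M C B =
  B ⊆ C × Indep M B × (∀ e → e ∈ C → e ∉ B → ¬ Indep M (⁅ e ⁆ ∪ B))

-- Independence in the contraction M / C, for a set Y disjoint from C:
-- Y ∪ B is independent in M for a basis B of C.
ContractIndep : ∀ {n} → Matroid n → Subset n → Subset n → Set
ContractIndep M C Y = Σ (Subset _) λ B → IsBasisOf M C B × Indep M (Y ∪ B)

-- M has a minor isomorphic to the independence system P on Fin m:
-- there are a contraction set C and an injection φ : Fin m → Fin n with
-- image disjoint from C (everything outside C ∪ im φ is deleted) such that
-- φ is an isomorphism from P onto (M / C) \ D, D = E - (C ∪ im φ).
HasMinorIso : ∀ {n m} → Matroid n → (Subset m → Set) → Set
HasMinorIso {n} {m} M P =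
  Σ (Subset n) λ C → Σ (Fin m → Fin n) λ φ →
    Injective _≡_ _≡_ φ × (∀ x → φ x ∉ C) ×
    (∀ X → P X ⇔ ContractIndep M C (image φ X))

-- Independent sets of the direct sum kN of k copies of N,
-- on the ground set Fin (k * m) ≅ Fin k × Fin m (via combine).
slice : ∀ {k m} → Fin k → Subset (k Data.Nat.* m) → Subset m
slice i X = tabulate (λ j → lookup X (combine i j))

copies : ∀ {m} (k : ℕ) → Matroid m → Subset (k Data.Nat.* m) → Set
copies k N X = ∀ (i : Fin k) → Indep N (slice i X)

-- M₂ is an elementary lift of M₁: there is a matroid M on Fin (suc n) and
-- an element e such that M₁ = M / e and M₂ = M \ e, where the ground set
-- Fin n is identified with Fin (suc n) - {e} via punchIn e.
IsElementaryLift : ∀ {n} → Matroid n → Matroid n → Set₁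
IsElementaryLift {n} M₂ M₁ =
  Σ (Matroid (suc n)) λ M → Σ (Fin (suc n)) λ e →
    (∀ X → Indep M₁ X ⇔ ContractIndep M ⁅ e ⁆ (image (punchIn e) X)) ×
    (∀ X → Indep M₂ X ⇔ Indep M (image (punchIn e) X))

-- Let M be the matroid with M₁ = M / e and M₂ = M \ e, and let C₁ and φ
-- exhibit kN as a minor of M₁. For a set Y of elements of kN put, in M,
-- a(Y) = r(φY ∪ C₁) and b(Y) = r(φY ∪ C₁ ∪ e). Then a ≤ b ≤ a + 1, and
-- b(Y) − b(∅) is the rank function of kN, so b is modular across different
-- copies of N. If e is spanned by C₁ and some copy Eᵢ, then b = a on every
-- superset of Eᵢ; otherwise b = a + 1 everywhere, by induction on Y using the
-- modularity of b and the submodularity of a. Either way b − a is constant on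
-- the supersets of Eᵢ, so in M₂ / (C₁ ∪ φEᵢ) the remaining k − 1 copies have
-- the rank function b(Eᵢ ∪ Y) − b(Eᵢ) = b(Y) − b(∅) of (k − 1)N.

module Submission where

open import Defs
open import Data.Bool using (Bool; T)
open import Data.Bool.Properties using (T-≡)
open import Data.Nat using (ℕ; zero; suc; _+_; _*_; _∸_; _≤_; _<_; _≤?_; z≤n; s≤s)
import Data.Nat as ℕ
open import Data.Nat.Tactic.RingSolver using (solve-∀)
open import Data.Nat.Properties
  using ( ≤-trans; ≤-antisym; ≤-reflexive; <⇒≱; ≰⇒>; +-suc; +-comm; +-identityʳ; m≤m+n; n≤0⇒n≡0
        ; +-mono-≤; +-monoʳ-≤; +-monoˡ-≤; +-cancelʳ-≤; +-cancelʳ-≡; +-cancelˡ-≡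
        ; +-assoc; ≤∧≢⇒<; ≤-pred; ≤-refl; <-≤-trans; module ≤-Reasoning)
open import Data.Fin using (Fin; zero; suc; _≟_; combine; quotient; remainder; punchIn; punchOut)
open import Data.Fin.Properties
  using ( any?; suc-injective; remQuot-combine; combine-remQuot; combine-injective
        ; punchIn-injective; punchInᵢ≢i; punchIn-punchOut)
open import Data.Fin.Subset
open import Data.Fin.Subset.Properties
open import Data.Vec using (_∷_; []; here; there; tabulate; lookup)
open import Data.Vec.Properties using (lookup∘tabulate; []=⇒lookup; lookup⇒[]=)
open import Data.Product using (∃; _×_; _,_; proj₁; proj₂; uncurry)
open import Data.Sum using (inj₁; inj₂; [_,_]′)
open import Data.Empty using (⊥-elim)
open import Function using (id; _∘_; _⇔_; mk⇔; Equivalence)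
open import Function.Properties.Equivalence using () renaming (trans to ⇔-trans; sym to ⇔-sym)
open import Function.Related.Propositional using (module EquationalReasoning)
open import Function.Definitions using (Injective)
open import Relation.Nullary using (yes; no; ¬?)
open import Relation.Nullary.Decidable using (toWitness; fromWitness; _×-dec_)
open import Relation.Binary.PropositionalEquality

private variable
  m n : ℕ
  p q r p′ q′ : Subset n

Disjoint : Subset n → Subset n → Set
Disjoint p q = ∀ {x} → x ∈ p → x ∉ q

∪-lub : p ⊆ r → q ⊆ r → p ∪ q ⊆ r
∪-lub {p = p} {q = q} p⊆r q⊆r x∈ = [ p⊆r , q⊆r ]′ (x∈p∪q⁻ p q x∈)

∪-mono : p ⊆ p′ → q ⊆ q′ → p ∪ q ⊆ p′ ∪ q′
∪-mono {p′ = p′} {q′ = q′} p⊆ q⊆ = ∪-lub (p⊆p∪q q′ ∘ p⊆) (q⊆p∪q p′ q′ ∘ q⊆)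

∣p∪q∣+∣p∩q∣≡∣p∣+∣q∣ : ∀ (p q : Subset n) → ∣ p ∪ q ∣ + ∣ p ∩ q ∣ ≡ ∣ p ∣ + ∣ q ∣
∣p∪q∣+∣p∩q∣≡∣p∣+∣q∣ []            []            = refl
∣p∪q∣+∣p∩q∣≡∣p∣+∣q∣ (outside ∷ p) (outside ∷ q) = ∣p∪q∣+∣p∩q∣≡∣p∣+∣q∣ p q
∣p∪q∣+∣p∩q∣≡∣p∣+∣q∣ (outside ∷ p) (inside ∷ q)  =
  trans (cong suc (∣p∪q∣+∣p∩q∣≡∣p∣+∣q∣ p q)) (sym (+-suc ∣ p ∣ ∣ q ∣))
∣p∪q∣+∣p∩q∣≡∣p∣+∣q∣ (inside ∷ p)  (outside ∷ q) = cong suc (∣p∪q∣+∣p∩q∣≡∣p∣+∣q∣ p q)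
∣p∪q∣+∣p∩q∣≡∣p∣+∣q∣ (inside ∷ p)  (inside ∷ q)  = cong suc (begin
  ∣ p ∪ q ∣ + suc ∣ p ∩ q ∣  ≡⟨ +-suc ∣ p ∪ q ∣ ∣ p ∩ q ∣ ⟩
  suc (∣ p ∪ q ∣ + ∣ p ∩ q ∣) ≡⟨ cong suc (∣p∪q∣+∣p∩q∣≡∣p∣+∣q∣ p q) ⟩
  suc (∣ p ∣ + ∣ q ∣)         ≡⟨ +-suc ∣ p ∣ ∣ q ∣ ⟨
  ∣ p ∣ + suc ∣ q ∣           ∎)
  where open ≡-Reasoning

disjoint⇒∣p∪q∣≡∣p∣+∣q∣ : Disjoint p q → ∣ p ∪ q ∣ ≡ ∣ p ∣ + ∣ q ∣
disjoint⇒∣p∪q∣≡∣p∣+∣q∣ {n} {p} {q} p#q = begin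
  ∣ p ∪ q ∣                  ≡⟨ +-identityʳ _ ⟨
  ∣ p ∪ q ∣ + 0              ≡⟨ cong (∣ p ∪ q ∣ +_) ∣p∩q∣≡0 ⟨
  ∣ p ∪ q ∣ + ∣ p ∩ q ∣      ≡⟨ ∣p∪q∣+∣p∩q∣≡∣p∣+∣q∣ p q ⟩
  ∣ p ∣ + ∣ q ∣              ∎
  where
  open ≡-Reasoning
  ∣p∩q∣≡0 : ∣ p ∩ q ∣ ≡ 0
  ∣p∩q∣≡0 = trans (cong ∣_∣ (Empty-unique λ (_ , x∈p∩q) → uncurry p#q (x∈p∩q⁻ p q x∈p∩q))) (∣⊥∣≡0 n)

x∈p⇒⁅x⁆⊆p : ∀ {x} → x ∈ p → ⁅ x ⁆ ⊆ p
x∈p⇒⁅x⁆⊆p {x = x} x∈p y∈⁅x⁆ = subst (_∈ _) (sym (x∈⁅y⁆⇒x≡y x y∈⁅x⁆)) x∈p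

∣⁅x⁆∪p∣≡1+∣p∣ : ∀ {x} → x ∉ p → ∣ ⁅ x ⁆ ∪ p ∣ ≡ suc ∣ p ∣
∣⁅x⁆∪p∣≡1+∣p∣ {x = x} x∉p =
  trans (disjoint⇒∣p∪q∣≡∣p∣+∣q∣ (λ y∈⁅x⁆ → subst (_∉ _) (sym (x∈⁅y⁆⇒x≡y x y∈⁅x⁆)) x∉p))
        (cong (_+ _) (∣⁅x⁆∣≡1 x))

⊆∧∣∣≥⇒⊇ : p ⊆ q → ∣ q ∣ ≤ ∣ p ∣ → q ⊆ p
⊆∧∣∣≥⇒⊇ {p = p} p⊆q ∣q∣≤∣p∣ {x} x∈q with x ∈? p
... | yes x∈p = x∈p
... | no  x∉p = ⊥-elim (<⇒≱ (p⊂q⇒∣p∣<∣q∣ (p⊆q , x , x∈q , x∉p)) ∣q∣≤∣p∣)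

x∈p─q⇒x∉q : ∀ (p q : Subset n) {x} → x ∈ p ─ q → x ∉ q
x∈p─q⇒x∉q (_ ∷ p) (outside ∷ q) (there x∈) (there x∈q) = x∈p─q⇒x∉q p q x∈ x∈q
x∈p─q⇒x∉q (_ ∷ p) (inside ∷ q)  (there x∈) (there x∈q) = x∈p─q⇒x∉q p q x∈ x∈q

p≡p∩q∪p─q : ∀ (p q : Subset n) → p ≡ (p ∩ q) ∪ (p ─ q)
p≡p∩q∪p─q p q = ⊆-antisym split (∪-lub (p∩q⊆p p q) (p─q⊆p p q))
  where
  split : p ⊆ (p ∩ q) ∪ (p ─ q)
  split {x} x∈p with x ∈? q
  ... | yes x∈q = p⊆p∪q _ (x∈p∩q⁺ (x∈p , x∈q))
  ... | no  x∉q = q⊆p∪q _ _ (x∈p∧x∉q⇒x∈p─q x∈p x∉q)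

∈-tabulate⁺ : ∀ {f : Fin n → Bool} {x} → T (f x) → x ∈ tabulate f
∈-tabulate⁺ {f = f} {x} t = lookup⇒[]= x _ (trans (lookup∘tabulate f x) (Equivalence.to T-≡ t))

∈-tabulate⁻ : ∀ {f : Fin n → Bool} {x} → x ∈ tabulate f → T (f x)
∈-tabulate⁻ {f = f} {x} x∈ = Equivalence.from T-≡ (trans (sym (lookup∘tabulate f x)) ([]=⇒lookup x∈))

preimage : (Fin m → Fin n) → Subset n → Subset m
preimage f K = tabulate (lookup K ∘ f)

∈-preimage⁺ : ∀ (f : Fin m → Fin n) {K x} → f x ∈ K → x ∈ preimage f K
∈-preimage⁺ f {x = x} fx∈K = lookup⇒[]= x _ (trans (lookup∘tabulate _ x) ([]=⇒lookup fx∈K))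

∈-preimage⁻ : ∀ (f : Fin m → Fin n) {K x} → x ∈ preimage f K → f x ∈ K
∈-preimage⁻ f {K} {x} x∈ = lookup⇒[]= (f x) K (trans (sym (lookup∘tabulate _ x)) ([]=⇒lookup x∈))

fibre : (Fin m → Fin n) → Fin n → Subset m
fibre f i = preimage f ⁅ i ⁆

∈-fibre⁺ : ∀ (f : Fin m → Fin n) {i x} → f x ≡ i → x ∈ fibre f i
∈-fibre⁺ f {i} fx≡i = ∈-preimage⁺ f (subst (_∈ ⁅ i ⁆) (sym fx≡i) (x∈⁅x⁆ i))

∈-fibre⁻ : ∀ (f : Fin m → Fin n) {i x} → x ∈ fibre f i → f x ≡ i
∈-fibre⁻ f x∈ = x∈⁅y⁆⇒x≡y _ (∈-preimage⁻ f x∈)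

module _ (φ : Fin m → Fin n) where

  ∈-image⁺ : ∀ {X x} → x ∈ X → φ x ∈ image φ X
  ∈-image⁺ x∈X = ∈-tabulate⁺ (fromWitness (_ , x∈X , refl))

  ∈-image⁻ : ∀ {X y} → y ∈ image φ X → ∃ λ x → x ∈ X × φ x ≡ y
  ∈-image⁻ y∈ = toWitness (∈-tabulate⁻ y∈)

  image-mono : ∀ {X Y} → X ⊆ Y → image φ X ⊆ image φ Y
  image-mono X⊆Y y∈ with ∈-image⁻ y∈
  ... | x , x∈X , refl = ∈-image⁺ (X⊆Y x∈X)

  image-⊥ : image φ ⊥ ≡ ⊥
  image-⊥ = ⊆-antisym (λ y∈ → let _ , x∈⊥ , _ = ∈-image⁻ y∈ in ⊥-elim (∉⊥ x∈⊥)) ⊥⊆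

  image-∪ : ∀ X Y → image φ (X ∪ Y) ≡ image φ X ∪ image φ Y
  image-∪ X Y = ⊆-antisym sub (∪-lub (image-mono (p⊆p∪q Y)) (image-mono (q⊆p∪q X Y)))
    where
    sub : image φ (X ∪ Y) ⊆ image φ X ∪ image φ Y
    sub y∈ with ∈-image⁻ y∈
    ... | x , x∈ , refl = [ p⊆p∪q _ ∘ ∈-image⁺ , q⊆p∪q _ _ ∘ ∈-image⁺ ]′ (x∈p∪q⁻ X Y x∈)

  module _ (φ-injective : Injective _≡_ _≡_ φ) where

    ∈-image-injective⁻ : ∀ {X x} → φ x ∈ image φ X → x ∈ X
    ∈-image-injective⁻ {X} φx∈ with ∈-image⁻ φx∈
    ... | _ , x′∈X , φx′≡φx = subst (_∈ X) (φ-injective φx′≡φx) x′∈X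

image-∘ : ∀ {l} (g : Fin m → Fin n) (f : Fin l → Fin m) X → image (g ∘ f) X ≡ image g (image f X)
image-∘ g f X = ⊆-antisym sub sup
  where
  sub : image (g ∘ f) X ⊆ image g (image f X)
  sub z∈ with ∈-image⁻ (g ∘ f) z∈
  ... | x , x∈X , refl = ∈-image⁺ g (∈-image⁺ f x∈X)
  sup : image g (image f X) ⊆ image (g ∘ f) X
  sup z∈ with ∈-image⁻ g z∈
  ... | y , y∈ , refl with ∈-image⁻ f y∈
  ...   | x , x∈X , refl = ∈-image⁺ (g ∘ f) x∈X

module _ (φ : Fin (suc m) → Fin n) (X : Subset m) where

  image-outside∷ : image φ (outside ∷ X) ≡ image (φ ∘ suc) X
  image-outside∷ = ⊆-antisym sub sup
    where
    sub : image φ (outside ∷ X) ⊆ image (φ ∘ suc) X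
    sub y∈ with ∈-image⁻ φ y∈
    ... | suc x , there x∈X , refl = ∈-image⁺ (φ ∘ suc) x∈X
    sup : image (φ ∘ suc) X ⊆ image φ (outside ∷ X)
    sup y∈ with ∈-image⁻ (φ ∘ suc) y∈
    ... | x , x∈X , refl = ∈-image⁺ φ (there x∈X)

  image-inside∷ : image φ (inside ∷ X) ≡ ⁅ φ zero ⁆ ∪ image (φ ∘ suc) X
  image-inside∷ = ⊆-antisym sub (∪-lub (x∈p⇒⁅x⁆⊆p (∈-image⁺ φ here)) sup)
    where
    sub : image φ (inside ∷ X) ⊆ ⁅ φ zero ⁆ ∪ image (φ ∘ suc) X
    sub y∈ with ∈-image⁻ φ y∈
    ... | zero  , _          , refl = p⊆p∪q _ (x∈⁅x⁆ (φ zero))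
    ... | suc x , there x∈X , refl = q⊆p∪q _ _ (∈-image⁺ (φ ∘ suc) x∈X)
    sup : image (φ ∘ suc) X ⊆ image φ (inside ∷ X)
    sup y∈ with ∈-image⁻ (φ ∘ suc) y∈
    ... | x , x∈X , refl = ∈-image⁺ φ (there x∈X)

∣image∣≡∣∣ : ∀ (φ : Fin m → Fin n) → Injective _≡_ _≡_ φ → ∀ X → ∣ image φ X ∣ ≡ ∣ X ∣
∣image∣≡∣∣ {zero} {n} φ _ [] = trans (cong ∣_∣ (image-⊥ φ)) (∣⊥∣≡0 n)
∣image∣≡∣∣ {suc m} φ φ-inj (outside ∷ X) = begin
  ∣ image φ (outside ∷ X) ∣ ≡⟨ cong ∣_∣ (image-outside∷ φ X) ⟩
  ∣ image (φ ∘ suc) X ∣     ≡⟨ ∣image∣≡∣∣ (φ ∘ suc) (suc-injective ∘ φ-inj) X ⟩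
  ∣ X ∣                     ∎
  where open ≡-Reasoning
∣image∣≡∣∣ {suc m} φ φ-inj (inside ∷ X) = begin
  ∣ image φ (inside ∷ X) ∣              ≡⟨ cong ∣_∣ (image-inside∷ φ X) ⟩
  ∣ ⁅ φ zero ⁆ ∪ image (φ ∘ suc) X ∣   ≡⟨ ∣⁅x⁆∪p∣≡1+∣p∣ φ0∉ ⟩
  suc ∣ image (φ ∘ suc) X ∣             ≡⟨ cong suc (∣image∣≡∣∣ (φ ∘ suc) (suc-injective ∘ φ-inj) X) ⟩
  suc ∣ X ∣                             ∎
  where
  open ≡-Reasoning
  φ0∉ : φ zero ∉ image (φ ∘ suc) X
  φ0∉ φ0∈ with ∈-image⁻ (φ ∘ suc) φ0∈
  ... | _ , _ , φsx≡φ0 with φ-inj φsx≡φ0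
  ... | ()

module _ (M : Matroid n) where

  private
    extendToBasisWithin : ∀ fuel {I X} → n ≤ fuel + ∣ I ∣ → Indep M I → I ⊆ X →
                          ∃ λ B → I ⊆ B × IsBasisOf M X B
    extendToBasisWithin fuel {I} {X} bound I-indep I⊆X
      with any? (λ x → (x ∈? X) ×-dec ¬? (x ∈? I) ×-dec Indep? M (⁅ x ⁆ ∪ I))
    ... | no maximal = I , id , I⊆X , I-indep , λ x x∈X x∉I indep → maximal (x , x∈X , x∉I , indep)
    ... | yes (x , x∈X , x∉I , indep) with fuel
    ...   | zero =
      ⊥-elim (<⇒≱ (≤-trans (≤-reflexive (sym (∣⁅x⁆∪p∣≡1+∣p∣ x∉I))) (∣p∣≤n (⁅ x ⁆ ∪ I))) bound)
    ...   | suc fuel′ =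
      let B , ⁅x⁆∪I⊆B , B-basis = extendToBasisWithin fuel′ bound′ indep (∪-lub (x∈p⇒⁅x⁆⊆p x∈X) I⊆X)
      in  B , ⁅x⁆∪I⊆B ∘ q⊆p∪q ⁅ x ⁆ I , B-basis
      where
      bound′ : n ≤ fuel′ + ∣ ⁅ x ⁆ ∪ I ∣
      bound′ = ≤-trans bound (≤-reflexive (trans (sym (+-suc fuel′ ∣ I ∣))
                                                 (cong (fuel′ +_) (sym (∣⁅x⁆∪p∣≡1+∣p∣ x∉I)))))

  extendToBasis : ∀ {I X} → Indep M I → I ⊆ X → ∃ λ B → I ⊆ B × IsBasisOf M X B
  extendToBasis = extendToBasisWithin n (m≤m+n n _)

  -- Abstract: unfolding the greedy construction makes unification explode.
  abstract
    basis : ∀ X → ∃ (IsBasisOf M X)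
    basis X = let B , _ , B-basis = extendToBasis (indep-∅ M) ⊥⊆ in B , B-basis

  rank : Subset n → ℕ
  rank X = ∣ proj₁ (basis X) ∣

  ∣basis∣≤∣basis∣ : ∀ {X B B′} → IsBasisOf M X B → IsBasisOf M X B′ → ∣ B′ ∣ ≤ ∣ B ∣
  ∣basis∣≤∣basis∣ {B = B} {B′} (B⊆X , B-indep , B-maximal) (B′⊆X , B′-indep , _) with ∣ B′ ∣ ≤? ∣ B ∣
  ... | yes ∣B′∣≤∣B∣ = ∣B′∣≤∣B∣
  ... | no  ∣B′∣≰∣B∣ =
    let x , x∈B′ , x∉B , indep = indep-aug M B-indep B′-indep (≰⇒> ∣B′∣≰∣B∣)
    in  ⊥-elim (B-maximal x (B′⊆X x∈B′) x∉B indep)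

  ∣basis∣≡rank : ∀ {X B} → IsBasisOf M X B → ∣ B ∣ ≡ rank X
  ∣basis∣≡rank B-basis = ≤-antisym (∣basis∣≤∣basis∣ (proj₂ (basis _)) B-basis)
                                   (∣basis∣≤∣basis∣ B-basis (proj₂ (basis _)))

  indep⇒∣∣≤rank : ∀ {I X} → Indep M I → I ⊆ X → ∣ I ∣ ≤ rank X
  indep⇒∣∣≤rank I-indep I⊆X =
    let B , I⊆B , B-basis = extendToBasis I-indep I⊆X
    in  ≤-trans (p⊆q⇒∣p∣≤∣q∣ I⊆B) (≤-reflexive (∣basis∣≡rank B-basis))

  rank-mono : ∀ {X Y} → X ⊆ Y → rank X ≤ rank Y
  rank-mono {X} X⊆Y = let B⊆X , B-indep , _ = proj₂ (basis X) in indep⇒∣∣≤rank B-indep (X⊆Y ∘ B⊆X)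

  rank≤∣∣ : ∀ X → rank X ≤ ∣ X ∣
  rank≤∣∣ X = p⊆q⇒∣p∣≤∣q∣ (proj₁ (proj₂ (basis X)))

  rank-⊥ : rank ⊥ ≡ 0
  rank-⊥ = n≤0⇒n≡0 (≤-trans (rank≤∣∣ ⊥) (≤-reflexive (∣⊥∣≡0 n)))

  indep⇒rank≡∣∣ : ∀ {X} → Indep M X → rank X ≡ ∣ X ∣
  indep⇒rank≡∣∣ {X} X-indep = ≤-antisym (rank≤∣∣ X) (indep⇒∣∣≤rank X-indep id)

  rank≡∣∣⇒indep : ∀ {X} → rank X ≡ ∣ X ∣ → Indep M X
  rank≡∣∣⇒indep {X} rank≡∣X∣ =
    let B⊆X , B-indep , _ = proj₂ (basis X)
    in  indep-⊆ M (⊆∧∣∣≥⇒⊇ B⊆X (≤-reflexive (sym rank≡∣X∣))) B-indep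

  basis-maximal : ∀ {X B K x} → IsBasisOf M X B → Indep M K → B ⊆ K → x ∈ K → x ∈ X → x ∈ B
  basis-maximal {B = B} {x = x} (_ , _ , B-maximal) K-indep B⊆K x∈K x∈X with x ∈? B
  ... | yes x∈B = x∈B
  ... | no  x∉B = ⊥-elim (B-maximal x x∈X x∉B (indep-⊆ M (∪-lub (x∈p⇒⁅x⁆⊆p x∈K) B⊆K) K-indep))

  -- A basis of A ∩ B, extended first to a basis of A and then to one of A ∪ B.
  rank-submodular : ∀ A B → rank (A ∪ B) + rank (A ∩ B) ≤ rank A + rank B
  rank-submodular A B = begin
    rank (A ∪ B) + rank (A ∩ B) ≡⟨ cong₂ _+_ (∣basis∣≡rank K-basis) (∣basis∣≡rank I-basis) ⟨
    ∣ K ∣ + ∣ I ∣                ≤⟨ +-mono-≤ (p⊆q⇒∣p∣≤∣q∣ K⊆IA∪KB) (p⊆q⇒∣p∣≤∣q∣ I⊆IA∩KB) ⟩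
    ∣ IA ∪ K ∩ B ∣ + ∣ IA ∩ (K ∩ B) ∣ ≡⟨ ∣p∪q∣+∣p∩q∣≡∣p∣+∣q∣ IA (K ∩ B) ⟩
    ∣ IA ∣ + ∣ K ∩ B ∣            ≤⟨ +-mono-≤ (≤-reflexive (∣basis∣≡rank IA-basis))
                                             (indep⇒∣∣≤rank (indep-⊆ M (p∩q⊆p K B) K-indep) (p∩q⊆q K B)) ⟩
    rank A + rank B              ∎
    where
    open ≤-Reasoning
    I = proj₁ (basis (A ∩ B))
    I-basis = proj₂ (basis (A ∩ B))
    I⊆A∩B = proj₁ I-basis
    IA-ext = extendToBasis (proj₁ (proj₂ I-basis)) (p∩q⊆p A B ∘ I⊆A∩B)
    IA = proj₁ IA-ext
    I⊆IA = proj₁ (proj₂ IA-ext)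
    IA-basis = proj₂ (proj₂ IA-ext)
    K-ext = extendToBasis (proj₁ (proj₂ IA-basis)) (p⊆p∪q B ∘ proj₁ IA-basis)
    K = proj₁ K-ext
    IA⊆K = proj₁ (proj₂ K-ext)
    K-basis = proj₂ (proj₂ K-ext)
    K-indep = proj₁ (proj₂ K-basis)
    K⊆IA∪KB : K ⊆ IA ∪ K ∩ B
    K⊆IA∪KB {x} x∈K with x∈p∪q⁻ A B (proj₁ K-basis x∈K)
    ... | inj₁ x∈A = p⊆p∪q _ (basis-maximal IA-basis K-indep IA⊆K x∈K x∈A)
    ... | inj₂ x∈B = q⊆p∪q IA _ (x∈p∩q⁺ (x∈K , x∈B))
    I⊆IA∩KB : I ⊆ IA ∩ (K ∩ B)
    I⊆IA∩KB x∈I =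
      x∈p∩q⁺ (I⊆IA x∈I , x∈p∩q⁺ (IA⊆K (I⊆IA x∈I) , proj₂ (x∈p∩q⁻ A B (I⊆A∩B x∈I))))

  rank-∪⁅x⁆≤1+rank : ∀ X x → rank (X ∪ ⁅ x ⁆) ≤ suc (rank X)
  rank-∪⁅x⁆≤1+rank X x = begin
    rank (X ∪ ⁅ x ⁆)                      ≤⟨ m≤m+n _ _ ⟩
    rank (X ∪ ⁅ x ⁆) + rank (X ∩ ⁅ x ⁆)   ≤⟨ rank-submodular X ⁅ x ⁆ ⟩
    rank X + rank ⁅ x ⁆                   ≤⟨ +-monoʳ-≤ (rank X) (≤-trans (rank≤∣∣ ⁅ x ⁆) (≤-reflexive (∣⁅x⁆∣≡1 x))) ⟩
    rank X + 1                            ≡⟨ +-comm (rank X) 1 ⟩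
    suc (rank X)                          ∎
    where open ≤-Reasoning

  rank-∪-spanning : ∀ {B C} → B ⊆ C → rank C ≤ rank B → ∀ Z → rank (Z ∪ C) ≤ rank (Z ∪ B)
  rank-∪-spanning {B} {C} B⊆C rankC≤rankB Z = +-cancelʳ-≤ (rank C) _ _ (begin
    rank (Z ∪ C) + rank C                   ≤⟨ +-mono-≤ (rank-mono (∪-mono (p⊆p∪q B) id))
                                                        (≤-trans rankC≤rankB (rank-mono B⊆Z∪B∩C)) ⟩
    rank ((Z ∪ B) ∪ C) + rank ((Z ∪ B) ∩ C) ≤⟨ rank-submodular (Z ∪ B) C ⟩
    rank (Z ∪ B) + rank C                   ∎)
    where
    open ≤-Reasoning
    B⊆Z∪B∩C : B ⊆ (Z ∪ B) ∩ C
    B⊆Z∪B∩C x∈B = x∈p∩q⁺ (q⊆p∪q Z B x∈B , B⊆C x∈B)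

  rank-∪-basis : ∀ {C B} → IsBasisOf M C B → ∀ Z → rank (Z ∪ C) ≡ rank (Z ∪ B)
  rank-∪-basis {C} {B} B-basis@(B⊆C , B-indep , _) Z =
    ≤-antisym (rank-∪-spanning B⊆C (≤-reflexive rankC≡rankB) Z) (rank-mono (∪-mono id B⊆C))
    where
    rankC≡rankB : rank C ≡ rank B
    rankC≡rankB = trans (sym (∣basis∣≡rank B-basis)) (sym (indep⇒rank≡∣∣ B-indep))

  rank-∪⁅x⁆≡rank-mono : ∀ {X Y} x → X ⊆ Y → rank (X ∪ ⁅ x ⁆) ≡ rank X → rank (Y ∪ ⁅ x ⁆) ≡ rank Y
  rank-∪⁅x⁆≡rank-mono {X} {Y} x X⊆Y rank≡ = ≤-antisym (begin
    rank (Y ∪ ⁅ x ⁆)          ≤⟨ rank-mono (∪-mono id (q⊆p∪q X ⁅ x ⁆)) ⟩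
    rank (Y ∪ (X ∪ ⁅ x ⁆))    ≤⟨ rank-∪-spanning (p⊆p∪q ⁅ x ⁆) (≤-reflexive rank≡) Y ⟩
    rank (Y ∪ X)              ≤⟨ rank-mono (∪-lub id X⊆Y) ⟩
    rank Y                    ∎) (rank-mono (p⊆p∪q ⁅ x ⁆))
    where open ≤-Reasoning

  contractIndep⇔rank : ∀ {C Y} → Disjoint Y C →
                       ContractIndep M C Y ⇔ (rank (Y ∪ C) ≡ ∣ Y ∣ + rank C)
  contractIndep⇔rank {C} {Y} Y#C = mk⇔ to from
    where
    ∣Y∪B∣ : ∀ {B} → IsBasisOf M C B → ∣ Y ∪ B ∣ ≡ ∣ Y ∣ + rank C
    ∣Y∪B∣ B-basis@(B⊆C , _) =
      trans (disjoint⇒∣p∪q∣≡∣p∣+∣q∣ (λ y∈Y y∈B → Y#C y∈Y (B⊆C y∈B)))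
            (cong (∣ Y ∣ +_) (∣basis∣≡rank B-basis))
    to : ContractIndep M C Y → rank (Y ∪ C) ≡ ∣ Y ∣ + rank C
    to (B , B-basis , Y∪B-indep) =
      trans (rank-∪-basis B-basis Y) (trans (indep⇒rank≡∣∣ Y∪B-indep) (∣Y∪B∣ B-basis))
    from : rank (Y ∪ C) ≡ ∣ Y ∣ + rank C → ContractIndep M C Y
    from rank≡ = let B , B-basis = basis C in
      B , B-basis , rank≡∣∣⇒indep (trans (sym (rank-∪-basis B-basis Y)) (trans rank≡ (sym (∣Y∪B∣ B-basis))))

  contractIndep-⊥⇔indep : ∀ {Y} → ContractIndep M ⊥ Y ⇔ Indep M Y
  contractIndep-⊥⇔indep {Y} = mk⇔ (λ (_ , _ , Y∪B-indep) → indep-⊆ M (p⊆p∪q _) Y∪B-indep)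
                                  (λ Y-indep → ⊥ , ⊥-basis , subst (Indep M) (sym (∪-identityʳ Y)) Y-indep)
    where
    ⊥-basis : IsBasisOf M ⊥ ⊥
    ⊥-basis = id , indep-∅ M , λ _ x∈⊥ → ⊥-elim (∉⊥ x∈⊥)

module _ (M : Matroid n) (ψ : Fin m → Fin n) (D : Subset n) where

  -- rank M (ψ Y ∪ D) is the rank of ψ Y in M / D, plus rank M D.
  minorRank : Subset m → ℕ
  minorRank Y = rank M (image ψ Y ∪ D)

  minorRank-mono : ∀ {X Y} → X ⊆ Y → minorRank X ≤ minorRank Y
  minorRank-mono X⊆Y = rank-mono M (∪-mono (image-mono ψ X⊆Y) id)

  minorRank-⊥ : minorRank ⊥ ≡ rank M D
  minorRank-⊥ = cong (rank M) (trans (cong (_∪ D) (image-⊥ ψ)) (∪-identityˡ D))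

  minorRank-submodular : ∀ X Y → minorRank (X ∪ Y) + minorRank ⊥ ≤ minorRank X + minorRank Y
  minorRank-submodular X Y = begin
    minorRank (X ∪ Y) + minorRank ⊥  ≡⟨ cong₂ (λ Z W → rank M (Z ∪ D) + W) (image-∪ ψ X Y) minorRank-⊥ ⟩
    rank M ((ψX ∪ ψY) ∪ D) + rank M D
                                     ≤⟨ +-mono-≤ (rank-mono M union⊆) (rank-mono M D⊆) ⟩
    rank M ((ψX ∪ D) ∪ (ψY ∪ D)) + rank M ((ψX ∪ D) ∩ (ψY ∪ D))
                                     ≤⟨ rank-submodular M (ψX ∪ D) (ψY ∪ D) ⟩
    minorRank X + minorRank Y        ∎
    where
    open ≤-Reasoning
    ψX = image ψ X
    ψY = image ψ Y
    union⊆ : (ψX ∪ ψY) ∪ D ⊆ (ψX ∪ D) ∪ (ψY ∪ D)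
    union⊆ = ∪-lub {p = ψX ∪ ψY} (∪-mono {p = ψX} {q = ψY} (p⊆p∪q D) (p⊆p∪q D))
                                 (p⊆p∪q (ψY ∪ D) ∘ q⊆p∪q ψX D)
    D⊆ : D ⊆ (ψX ∪ D) ∩ (ψY ∪ D)
    D⊆ x∈D = x∈p∩q⁺ (q⊆p∪q ψX D x∈D , q⊆p∪q ψY D x∈D)

  module _ (ψ-injective : Injective _≡_ _≡_ ψ) (ψ∉D : ∀ x → ψ x ∉ D) where

    image#D : ∀ X → Disjoint (image ψ X) D
    image#D X y∈ with ∈-image⁻ ψ y∈
    ... | x , _ , refl = ψ∉D x

    contractIndep⇔minorRank : ∀ X → ContractIndep M D (image ψ X) ⇔ (minorRank X ≡ ∣ X ∣ + rank M D)
    contractIndep⇔minorRank X =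
      subst (λ k → ContractIndep M D (image ψ X) ⇔ (minorRank X ≡ k + rank M D))
            (∣image∣≡∣∣ ψ ψ-injective X) (contractIndep⇔rank M (image#D X))

    -- I is the part inside ψ Y of a basis of ψ Y ∪ D extending a basis of D.
    minorRank-independentSpanning : ∀ Y → ∃ λ I →
      I ⊆ Y × minorRank I ≡ ∣ I ∣ + rank M D × minorRank I ≡ minorRank Y
    minorRank-independentSpanning Y =
      I , I⊆Y , trans minorRank-I≡∣K∣ ∣K∣≡ , trans minorRank-I≡∣K∣ (∣basis∣≡rank M K-basis)
      where
      BD = proj₁ (basis M D)
      BD-basis = proj₂ (basis M D)
      K-ext = extendToBasis M (proj₁ (proj₂ BD-basis)) (q⊆p∪q (image ψ Y) D ∘ proj₁ BD-basis)
      K = proj₁ K-ext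
      BD⊆K = proj₁ (proj₂ K-ext)
      K-basis = proj₂ (proj₂ K-ext)
      I = preimage ψ K
      I⊆Y : I ⊆ Y
      I⊆Y {y} y∈I with x∈p∪q⁻ (image ψ Y) D (proj₁ K-basis (∈-preimage⁻ ψ y∈I))
      ... | inj₁ ψy∈ = ∈-image-injective⁻ ψ ψ-injective ψy∈
      ... | inj₂ ψy∈D = ⊥-elim (ψ∉D y ψy∈D)
      K≡ : K ≡ image ψ I ∪ BD
      K≡ = ⊆-antisym sub (∪-lub sup BD⊆K)
        where
        sub : K ⊆ image ψ I ∪ BD
        sub {x} x∈K with x∈p∪q⁻ (image ψ Y) D (proj₁ K-basis x∈K)
        ... | inj₂ x∈D = q⊆p∪q _ BD (basis-maximal M BD-basis (proj₁ (proj₂ K-basis)) BD⊆K x∈K x∈D)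
        ... | inj₁ x∈ψY with ∈-image⁻ ψ x∈ψY
        ...   | y , _ , refl = p⊆p∪q BD (∈-image⁺ ψ (∈-preimage⁺ ψ x∈K))
        sup : image ψ I ⊆ K
        sup x∈ with ∈-image⁻ ψ x∈
        ... | y , y∈I , refl = ∈-preimage⁻ ψ y∈I
      minorRank-I≡∣K∣ : minorRank I ≡ ∣ K ∣
      minorRank-I≡∣K∣ = trans (rank-∪-basis M BD-basis (image ψ I))
                              (trans (cong (rank M) (sym K≡)) (indep⇒rank≡∣∣ M (proj₁ (proj₂ K-basis))))
      ∣K∣≡ : ∣ K ∣ ≡ ∣ I ∣ + rank M D
      ∣K∣≡ = begin
        ∣ K ∣                    ≡⟨ cong ∣_∣ K≡ ⟩
        ∣ image ψ I ∪ BD ∣       ≡⟨ disjoint⇒∣p∪q∣≡∣p∣+∣q∣ (λ x∈ x∈BD → image#D I x∈ (proj₁ BD-basis x∈BD)) ⟩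
        ∣ image ψ I ∣ + ∣ BD ∣   ≡⟨ cong₂ _+_ (∣image∣≡∣∣ ψ ψ-injective I) (∣basis∣≡rank M BD-basis) ⟩
        ∣ I ∣ + rank M D         ∎
        where open ≡-Reasoning

    rank-minor : (N : Matroid m) → (∀ X → Indep N X ⇔ ContractIndep M D (image ψ X)) →
                 ∀ Z → rank N Z + rank M D ≡ minorRank Z
    rank-minor N N≅M/D Z = ≤-antisym upper lower
      where
      upper : rank N Z + rank M D ≤ minorRank Z
      upper = let B , B⊆Z , B-indep , _ = basis N Z in begin
        rank N Z + rank M D   ≡⟨ cong (_+ rank M D) (∣basis∣≡rank N (proj₂ (basis N Z))) ⟨
        ∣ B ∣ + rank M D      ≡⟨ Equivalence.to (contractIndep⇔minorRank B) (Equivalence.to (N≅M/D B) B-indep) ⟨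
        minorRank B           ≤⟨ minorRank-mono B⊆Z ⟩
        minorRank Z           ∎
        where open ≤-Reasoning
      lower : minorRank Z ≤ rank N Z + rank M D
      lower = let I , I⊆Z , minorRank-I≡ , minorRank-I≡Z = minorRank-independentSpanning Z
                  I-indep = Equivalence.from (N≅M/D I) (Equivalence.from (contractIndep⇔minorRank I) minorRank-I≡)
              in begin
        minorRank Z           ≡⟨ trans (sym minorRank-I≡Z) minorRank-I≡ ⟩
        ∣ I ∣ + rank M D      ≤⟨ +-monoˡ-≤ (rank M D) (indep⇒∣∣≤rank N I-indep I⊆Z) ⟩
        rank N Z + rank M D   ∎
        where open ≤-Reasoning

block : ∀ {k} m → Fin k → Subset (k * m)
block m = fibre (quotient m)

module _ {k m : ℕ} where

  quotient-combine : ∀ (i : Fin k) (x : Fin m) → quotient m (combine i x) ≡ i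
  quotient-combine i x = cong proj₁ (remQuot-combine i x)

  remainder-combine : ∀ (i : Fin k) (x : Fin m) → remainder {k} m (combine i x) ≡ x
  remainder-combine i x = cong proj₂ (remQuot-combine i x)

  combine∈block : ∀ (i : Fin k) (x : Fin m) → combine i x ∈ block m i
  combine∈block i x = ∈-fibre⁺ (quotient m) (quotient-combine i x)

  copies-∪ : ∀ (N : Matroid m) {i A B} → A ⊆ block m i → Disjoint B (block m i) →
             copies k N A → copies k N B → copies k N (A ∪ B)
  copies-∪ N {i} {A} {B} A⊆block B#block A-copies B-copies c with c ≟ i
  ... | yes refl = indep-⊆ N (λ x∈ → ∈-preimage⁺ (combine c) (in-A (∈-preimage⁻ (combine c) x∈))) (A-copies c)
    where
    in-A : ∀ {x} → combine c x ∈ A ∪ B → combine c x ∈ A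
    in-A {x} ∈A∪B = [ id , (λ ∈B → ⊥-elim (B#block ∈B (combine∈block c x))) ]′ (x∈p∪q⁻ A B ∈A∪B)
  ... | no c≢i = indep-⊆ N (λ x∈ → ∈-preimage⁺ (combine c) (in-B (∈-preimage⁻ (combine c) x∈))) (B-copies c)
    where
    in-B : ∀ {x} → combine c x ∈ A ∪ B → combine c x ∈ B
    in-B {x} ∈A∪B = [ (λ ∈A → ⊥-elim (c≢i (c≡i ∈A))) , id ]′ (x∈p∪q⁻ A B ∈A∪B)
      where
      c≡i : combine c x ∈ A → c ≡ i
      c≡i ∈A = trans (sym (quotient-combine c x)) (∈-fibre⁻ (quotient m) (A⊆block ∈A))

module _ {K m : ℕ} (i : Fin (suc K)) where

  skipBlock : Fin (K * m) → Fin (suc K * m)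
  skipBlock p = combine (punchIn i (quotient m p)) (remainder {K} m p)

  skipBlock-combine : ∀ j x → skipBlock (combine j x) ≡ combine (punchIn i j) x
  skipBlock-combine j x = cong₂ (λ j′ x′ → combine (punchIn i j′) x′) (quotient-combine j x) (remainder-combine j x)

  skipBlock-injective : Injective _≡_ _≡_ skipBlock
  skipBlock-injective {p} {p′} eq =
    let q≡q′ , r≡r′ = combine-injective _ _ _ _ eq
    in  begin
      p                                               ≡⟨ combine-remQuot {K} m p ⟨
      combine (quotient {K} m p) (remainder {K} m p)   ≡⟨ cong₂ combine (punchIn-injective i _ _ q≡q′) r≡r′ ⟩
      combine (quotient {K} m p′) (remainder {K} m p′) ≡⟨ combine-remQuot {K} m p′ ⟩
      p′                                              ∎
    where open ≡-Reasoning

  skipBlock∉block : ∀ p → skipBlock p ∉ block m i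
  skipBlock∉block p ∈block =
    punchInᵢ≢i i _ (trans (sym (quotient-combine {m = m} _ (remainder {K} m p))) (∈-fibre⁻ (quotient m) ∈block))

  image-skipBlock#block : ∀ X → Disjoint (image skipBlock X) (block m i)
  image-skipBlock#block X y∈ with ∈-image⁻ skipBlock y∈
  ... | p , _ , refl = skipBlock∉block p

  slice-image-skipBlock : ∀ j X → slice (punchIn i j) (image skipBlock X) ≡ slice j X
  slice-image-skipBlock j X = ⊆-antisym
    (λ x∈ → ∈-preimage⁺ (combine j) (∈-image-injective⁻ skipBlock skipBlock-injective
              (subst (_∈ image skipBlock X) (sym (skipBlock-combine j _)) (∈-preimage⁻ (combine (punchIn i j)) x∈))))
    (λ x∈ → ∈-preimage⁺ (combine (punchIn i j))
              (subst (_∈ image skipBlock X) (skipBlock-combine j _) (∈-image⁺ skipBlock (∈-preimage⁻ (combine j) x∈))))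

  copies⇔copies-image-skipBlock : ∀ (N : Matroid m) X → copies K N X ⇔ copies (suc K) N (image skipBlock X)
  copies⇔copies-image-skipBlock N X = mk⇔ to from
    where
    to : copies K N X → copies (suc K) N (image skipBlock X)
    to X-copies c with i ≟ c
    ... | yes refl = indep-⊆ N slice⊆⊥ (indep-∅ N)
      where
      slice⊆⊥ : slice i (image skipBlock X) ⊆ ⊥
      slice⊆⊥ {x} x∈ = ⊥-elim (image-skipBlock#block X (∈-preimage⁻ (combine i) x∈) (combine∈block i x))
    ... | no i≢c = subst (λ c′ → Indep N (slice c′ (image skipBlock X))) (punchIn-punchOut i≢c)
                         (subst (Indep N) (sym (slice-image-skipBlock (punchOut i≢c) X)) (X-copies (punchOut i≢c)))
    from : copies (suc K) N (image skipBlock X) → copies K N X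
    from Y-copies j = subst (Indep N) (slice-image-skipBlock j X) (Y-copies (punchIn i j))

+-offset-⇔ : ∀ {u v w c U V : ℕ} → u + c ≡ U → v + c ≡ V → (u ≡ w + v) ⇔ (U ≡ w + V)
+-offset-⇔ {u} {v} {w} {c} refl refl =
  mk⇔ (λ u≡w+v → trans (cong (_+ c) u≡w+v) (+-assoc w v c))
      (λ eq → +-cancelʳ-≡ c u (w + v) (trans eq (sym (+-assoc w v c))))

modular-⇔ : ∀ {x y z c w : ℕ} → x + z ≡ c + y → (y ≡ w + z) ⇔ (x ≡ w + c)
modular-⇔ {x} {y} {z} {c} {w} x+z≡c+y = mk⇔
  (λ y≡w+z → +-cancelʳ-≡ z x (w + c) (trans x+z≡c+y (trans (cong (c +_) y≡w+z) swap)))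
  (λ x≡w+c → +-cancelˡ-≡ c y (w + z) (trans (sym x+z≡c+y) (trans (cong (_+ z) x≡w+c) (sym swap))))
  where
  swap : c + (w + z) ≡ (w + c) + z
  swap = trans (sym (+-assoc c w z)) (cong (_+ z) (+-comm c w))

-- Induction on ∣ Y ∣: split Y into its part in the fibre of one of its
-- elements and the rest; b is modular and a submodular across that split.
module _ {N k : ℕ} (f : Fin N → Fin (suc k)) (a b : Subset N → ℕ)
         (a-submodular : ∀ A B → a (A ∪ B) + a ⊥ ≤ a A + a B)
         (b-modular : ∀ i {A B} → A ⊆ fibre f i → Disjoint B (fibre f i) → b (A ∪ B) + b ⊥ ≡ b A + b B)
         (a≤b : ∀ Y → a Y ≤ b Y) (b≤1+a : ∀ Y → b Y ≤ suc (a Y))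
         (b≡a-mono : ∀ {Y Z} → Y ⊆ Z → b Y ≡ a Y → b Z ≡ a Z)
         (b≢a-fibre : ∀ i → b (fibre f i) ≢ a (fibre f i)) where

  private
    b≡1+a-inFibre : ∀ i {Y} → Y ⊆ fibre f i → b Y ≡ suc (a Y)
    b≡1+a-inFibre i {Y} Y⊆fibre =
      ≤-antisym (b≤1+a Y) (≤∧≢⇒< (a≤b Y) (λ aY≡bY → b≢a-fibre i (b≡a-mono Y⊆fibre (sym aY≡bY))))

    b≡1+a-bounded : ∀ s Y → ∣ Y ∣ < s → b Y ≡ suc (a Y)
    b≡1+a-bounded (suc s) Y ∣Y∣<1+s with nonempty? Y
    ... | no Y-empty = b≡1+a-inFibre zero (λ y∈Y → ⊥-elim (Y-empty (_ , y∈Y)))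
    ... | yes (y , y∈Y) = begin-equality
      b Y                            ≡⟨ cong b (p≡p∩q∪p─q Y E) ⟩
      b (A ∪ B)                      ≡⟨ ≤-antisym (b≤1+a (A ∪ B)) (+-cancelʳ-≤ (b ⊥) _ _ 1+a+b⊥≤b+b⊥) ⟩
      suc (a (A ∪ B))                ≡⟨ cong (suc ∘ a) (p≡p∩q∪p─q Y E) ⟨
      suc (a Y)                      ∎
      where
      open ≤-Reasoning
      E = fibre f (f y)
      A = Y ∩ E
      B = Y ─ E
      ∣B∣<s : ∣ B ∣ < s
      ∣B∣<s = <-≤-trans (p∩q≢∅⇒∣p─q∣<∣p∣ Y E (y , x∈p∩q⁺ (y∈Y , ∈-fibre⁺ f refl))) (≤-pred ∣Y∣<1+s)
      1+a+b⊥≤b+b⊥ : suc (a (A ∪ B)) + b ⊥ ≤ b (A ∪ B) + b ⊥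
      1+a+b⊥≤b+b⊥ = begin
        suc (a (A ∪ B)) + b ⊥          ≡⟨ cong (suc (a (A ∪ B)) +_) (b≡1+a-inFibre (f y) (⊥⊆ {p = E})) ⟩
        suc (a (A ∪ B)) + suc (a ⊥)    ≡⟨ cong suc (+-suc (a (A ∪ B)) (a ⊥)) ⟩
        suc (suc (a (A ∪ B) + a ⊥))    ≤⟨ s≤s (s≤s (a-submodular A B)) ⟩
        suc (suc (a A + a B))          ≡⟨ cong suc (+-suc (a A) (a B)) ⟨
        suc (a A) + suc (a B)          ≡⟨ cong₂ _+_ (b≡1+a-inFibre (f y) (p∩q⊆q Y E)) (b≡1+a-bounded s B ∣B∣<s) ⟨
        b A + b B                      ≡⟨ b-modular (f y) (p∩q⊆q Y E) (x∈p─q⇒x∉q Y E) ⟨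
        b (A ∪ B) + b ⊥                ∎

  fibrewise-b≢a⇒b≡1+a : ∀ Y → b Y ≡ suc (a Y)
  fibrewise-b≢a⇒b≡1+a Y = b≡1+a-bounded (suc ∣ Y ∣) Y ≤-refl

module _ {n m K : ℕ} (N : Matroid m) (M : Matroid (suc n)) (e : Fin (suc n)) {M₁ M₂ : Matroid n}
         (M₁≅M/e : ∀ X → Indep M₁ X ⇔ ContractIndep M ⁅ e ⁆ (image (punchIn e) X))
         (M₂≅M\e : ∀ X → Indep M₂ X ⇔ Indep M (image (punchIn e) X))
         (C₁ : Subset n) (φ : Fin (suc K * m) → Fin n)
         (φ-injective : Injective _≡_ _≡_ φ) (φ∉C₁ : ∀ x → φ x ∉ C₁)
         (kN≅M₁/C₁ : ∀ X → copies (suc K) N X ⇔ ContractIndep M₁ C₁ (image φ X)) where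

  private
    ι : Fin n → Fin (suc n)
    ι = punchIn e

    ι-injective : Injective _≡_ _≡_ ι
    ι-injective = punchIn-injective e _ _

    Φ : Fin (suc K * m) → Fin (suc n)
    Φ = ι ∘ φ

    Φ-injective : Injective _≡_ _≡_ Φ
    Φ-injective = φ-injective ∘ ι-injective

    ε D : Subset (suc n)
    ε = ⁅ e ⁆
    D = image ι C₁

    a b : Subset (suc K * m) → ℕ
    a = minorRank M Φ D
    b = minorRank M Φ (D ∪ ε)

    ι∉ε : ∀ x → ι x ∉ ε
    ι∉ε x x∈ε = punchInᵢ≢i e x (x∈⁅y⁆⇒x≡y e x∈ε)

    Φ∉D∪ε : ∀ x → Φ x ∉ D ∪ ε
    Φ∉D∪ε x Φx∈ with x∈p∪q⁻ D ε Φx∈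
    ... | inj₁ Φx∈D = φ∉C₁ x (∈-image-injective⁻ ι ι-injective Φx∈D)
    ... | inj₂ Φx∈ε = ι∉ε (φ x) Φx∈ε

    rank-M₁ : ∀ Z → rank M₁ Z + rank M ε ≡ rank M (image ι Z ∪ ε)
    rank-M₁ = rank-minor M ι ε ι-injective ι∉ε M₁ M₁≅M/e

    rank-M₂ : ∀ Z → rank M₂ Z ≡ rank M (image ι Z)
    rank-M₂ Z = begin
      rank M₂ Z                ≡⟨ +-identityʳ _ ⟨
      rank M₂ Z + 0            ≡⟨ cong (rank M₂ Z +_) (rank-⊥ M) ⟨
      rank M₂ Z + rank M ⊥     ≡⟨ rank-minor M ι ⊥ ι-injective (λ _ → ∉⊥) M₂ M₂≅M/⊥ Z ⟩
      rank M (image ι Z ∪ ⊥)   ≡⟨ cong (rank M) (∪-identityʳ _) ⟩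
      rank M (image ι Z)       ∎
      where
      open ≡-Reasoning
      M₂≅M/⊥ : ∀ X → Indep M₂ X ⇔ ContractIndep M ⊥ (image ι X)
      M₂≅M/⊥ X = ⇔-trans (M₂≅M\e X) (⇔-sym (contractIndep-⊥⇔indep M))

    a≡rank-ι : ∀ Z → a Z ≡ rank M (image ι (image φ Z ∪ C₁))
    a≡rank-ι Z = cong (rank M) (sym (trans (image-∪ ι (image φ Z) C₁) (cong (_∪ D) (sym (image-∘ ι φ Z)))))

    b≡rank-a∪ε : ∀ Y → b Y ≡ rank M ((image Φ Y ∪ D) ∪ ε)
    b≡rank-a∪ε Y = cong (rank M) (sym (∪-assoc (image Φ Y) D ε))

    a≤b : ∀ Y → a Y ≤ b Y
    a≤b Y = ≤-trans (rank-mono M (p⊆p∪q ε)) (≤-reflexive (sym (b≡rank-a∪ε Y)))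

    b≤1+a : ∀ Y → b Y ≤ suc (a Y)
    b≤1+a Y = ≤-trans (≤-reflexive (b≡rank-a∪ε Y)) (rank-∪⁅x⁆≤1+rank M (image Φ Y ∪ D) e)

    b≡a-mono : ∀ {Y Z} → Y ⊆ Z → b Y ≡ a Y → b Z ≡ a Z
    b≡a-mono Y⊆Z bY≡aY = trans (b≡rank-a∪ε _)
      (rank-∪⁅x⁆≡rank-mono M e (∪-mono (image-mono Φ Y⊆Z) id) (trans (sym (b≡rank-a∪ε _)) bY≡aY))

    copies⇔b : ∀ X → copies (suc K) N X ⇔ (b X ≡ ∣ X ∣ + b ⊥)
    copies⇔b X = begin
      copies (suc K) N X                                ∼⟨ kN≅M₁/C₁ X ⟩
      ContractIndep M₁ C₁ (image φ X)                   ∼⟨ contractIndep⇔minorRank M₁ φ C₁ φ-injective φ∉C₁ X ⟩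
      (rank M₁ (image φ X ∪ C₁) ≡ ∣ X ∣ + rank M₁ C₁)   ∼⟨ +-offset-⇔ (trans (rank-M₁ _) (cong (rank M) ι[φX∪C₁]∪ε))
                                                                      (trans (rank-M₁ C₁) (sym (minorRank-⊥ M Φ (D ∪ ε)))) ⟩
      (b X ≡ ∣ X ∣ + b ⊥)                               ∎
      where
      open EquationalReasoning
      ι[φX∪C₁]∪ε : image ι (image φ X ∪ C₁) ∪ ε ≡ image Φ X ∪ (D ∪ ε)
      ι[φX∪C₁]∪ε = trans (cong (_∪ ε) (trans (image-∪ ι (image φ X) C₁) (cong (_∪ D) (sym (image-∘ ι φ X)))))
                         (∪-assoc (image Φ X) D ε)

    -- ≥: independent spanning subsets of A and B have an independent union in
    -- kN, as A and B lie in different copies of N.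
    b-modular : ∀ (i : Fin (suc K)) {A B} → A ⊆ block m i → Disjoint B (block m i) → b (A ∪ B) + b ⊥ ≡ b A + b B
    b-modular i {A} {B} A⊆block B#block = ≤-antisym (minorRank-submodular M Φ (D ∪ ε) A B) (begin
      b A + b B                              ≡⟨ cong₂ _+_ (sym bIA≡bA) (sym bIB≡bB) ⟩
      b IA + b IB                            ≡⟨ cong₂ _+_ (Equivalence.to (copies⇔b IA) IA-copies)
                                                          (Equivalence.to (copies⇔b IB) IB-copies) ⟩
      (∣ IA ∣ + b ⊥) + (∣ IB ∣ + b ⊥)         ≡⟨ regroup ∣ IA ∣ ∣ IB ∣ (b ⊥) ⟩
      (∣ IA ∣ + ∣ IB ∣ + b ⊥) + b ⊥           ≡⟨ cong (λ k → k + b ⊥ + b ⊥) (disjoint⇒∣p∪q∣≡∣p∣+∣q∣ IA#IB) ⟨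
      (∣ IA ∪ IB ∣ + b ⊥) + b ⊥              ≡⟨ cong (_+ b ⊥) (Equivalence.to (copies⇔b (IA ∪ IB)) IA∪IB-copies) ⟨
      b (IA ∪ IB) + b ⊥                      ≤⟨ +-monoˡ-≤ (b ⊥) (minorRank-mono M Φ (D ∪ ε) (∪-mono IA⊆A IB⊆B)) ⟩
      b (A ∪ B) + b ⊥                        ∎)
      where
      open ≤-Reasoning
      spanning = minorRank-independentSpanning M Φ (D ∪ ε) Φ-injective Φ∉D∪ε
      IA = proj₁ (spanning A)
      IB = proj₁ (spanning B)
      IA⊆A = proj₁ (proj₂ (spanning A))
      IB⊆B = proj₁ (proj₂ (spanning B))
      bIA≡bA = proj₂ (proj₂ (proj₂ (spanning A)))
      bIB≡bB = proj₂ (proj₂ (proj₂ (spanning B)))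
      b-indep : ∀ I → b I ≡ ∣ I ∣ + rank M (D ∪ ε) → copies (suc K) N I
      b-indep I bI≡ = Equivalence.from (copies⇔b I) (trans bI≡ (cong (∣ I ∣ +_) (sym (minorRank-⊥ M Φ (D ∪ ε)))))
      IA-copies = b-indep IA (proj₁ (proj₂ (proj₂ (spanning A))))
      IB-copies = b-indep IB (proj₁ (proj₂ (proj₂ (spanning B))))
      IA∪IB-copies = copies-∪ N {i} (A⊆block ∘ IA⊆A) (B#block ∘ IB⊆B) IA-copies IB-copies
      IA#IB : Disjoint IA IB
      IA#IB x∈IA x∈IB = B#block (IB⊆B x∈IB) (A⊆block (IA⊆A x∈IA))
      regroup : ∀ x y z → (x + z) + (y + z) ≡ (x + y + z) + z
      regroup = solve-∀

    minorOfBlockContraction : ∀ (i : Fin (suc K)) δ → (∀ Y → block m i ⊆ Y → a Y + δ ≡ b Y) →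
                              HasMinorIso M₂ (copies K N)
    minorOfBlockContraction i δ a+δ≡b = C₂ , ψ , ψ-injective , ψ∉C₂ , kN≅M₂/C₂
      where
      σ = skipBlock {K} {m} i
      σ-injective = skipBlock-injective i
      Eᵢ = block m i
      ψ = φ ∘ σ
      ψ-injective : Injective _≡_ _≡_ ψ
      ψ-injective = σ-injective ∘ φ-injective
      C₂ = C₁ ∪ image φ Eᵢ
      ψ∉C₂ : ∀ x → ψ x ∉ C₂
      ψ∉C₂ x ψx∈ with x∈p∪q⁻ C₁ (image φ Eᵢ) ψx∈
      ... | inj₁ ψx∈C₁ = φ∉C₁ (σ x) ψx∈C₁
      ... | inj₂ ψx∈φEᵢ = skipBlock∉block i x (∈-image-injective⁻ φ φ-injective ψx∈φEᵢ)
      a≡rank-M₂-C₂ : a Eᵢ ≡ rank M₂ C₂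
      a≡rank-M₂-C₂ =
        trans (a≡rank-ι Eᵢ) (trans (cong (rank M ∘ image ι) (∪-comm (image φ Eᵢ) C₁)) (sym (rank-M₂ C₂)))
      a≡rank-M₂ : ∀ X → a (Eᵢ ∪ image σ X) ≡ rank M₂ (image ψ X ∪ C₂)
      a≡rank-M₂ X = trans (a≡rank-ι _) (trans (cong (rank M ∘ image ι) sets) (sym (rank-M₂ _)))
        where
        sets : image φ (Eᵢ ∪ image σ X) ∪ C₁ ≡ image ψ X ∪ C₂
        sets = begin
          image φ (Eᵢ ∪ image σ X) ∪ C₁           ≡⟨ cong (_∪ C₁) (image-∪ φ Eᵢ (image σ X)) ⟩
          (image φ Eᵢ ∪ image φ (image σ X)) ∪ C₁ ≡⟨ ∪-assoc (image φ Eᵢ) _ C₁ ⟩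
          image φ Eᵢ ∪ (image φ (image σ X) ∪ C₁) ≡⟨ ∪-comm (image φ Eᵢ) _ ⟩
          (image φ (image σ X) ∪ C₁) ∪ image φ Eᵢ ≡⟨ ∪-assoc _ C₁ (image φ Eᵢ) ⟩
          image φ (image σ X) ∪ C₂               ≡⟨ cong (_∪ C₂) (image-∘ φ σ X) ⟨
          image ψ X ∪ C₂                         ∎
          where open ≡-Reasoning

      kN≅M₂/C₂ : ∀ X → copies K N X ⇔ ContractIndep M₂ C₂ (image ψ X)
      kN≅M₂/C₂ X = begin
        copies K N X                                  ∼⟨ copies⇔copies-image-skipBlock i N X ⟩
        copies (suc K) N (image σ X)                  ∼⟨ copies⇔b (image σ X) ⟩
        (b (image σ X) ≡ ∣ image σ X ∣ + b ⊥)          ≡⟨ cong (λ k → b (image σ X) ≡ k + b ⊥) (∣image∣≡∣∣ σ σ-injective X) ⟩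
        (b (image σ X) ≡ ∣ X ∣ + b ⊥)                 ∼⟨ modular-⇔ (b-modular i id (image-skipBlock#block i X)) ⟩
        (b (Eᵢ ∪ image σ X) ≡ ∣ X ∣ + b Eᵢ)           ∼⟨ ⇔-sym (+-offset-⇔ (a+δ≡b _ (p⊆p∪q _)) (a+δ≡b Eᵢ id)) ⟩
        (a (Eᵢ ∪ image σ X) ≡ ∣ X ∣ + a Eᵢ)           ≡⟨ cong₂ (λ s t → s ≡ ∣ X ∣ + t) (a≡rank-M₂ X) (a≡rank-M₂-C₂) ⟩
        (rank M₂ (image ψ X ∪ C₂) ≡ ∣ X ∣ + rank M₂ C₂) ∼⟨ ⇔-sym (contractIndep⇔minorRank M₂ ψ C₂ ψ-injective ψ∉C₂ X) ⟩
        ContractIndep M₂ C₂ (image ψ X)               ∎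
        where open EquationalReasoning

  elementaryLift-hasMinorIso : HasMinorIso M₂ (copies K N)
  elementaryLift-hasMinorIso with any? (λ i → a (block m i) ℕ.≟ b (block m i))
  ... | yes (i , aEᵢ≡bEᵢ) =
    minorOfBlockContraction i 0 λ Y Eᵢ⊆Y → trans (+-identityʳ (a Y)) (sym (b≡a-mono Eᵢ⊆Y (sym aEᵢ≡bEᵢ)))
  ... | no ¬aEᵢ≡bEᵢ =
    minorOfBlockContraction zero 1 λ Y _ → trans (+-comm (a Y) 1) (sym (b≡1+a Y))
    where
    b≡1+a : ∀ Y → b Y ≡ suc (a Y)
    b≡1+a = fibrewise-b≢a⇒b≡1+a (quotient m) a b (minorRank-submodular M Φ D) b-modular a≤b b≤1+a b≡a-mono
                   (λ i bEᵢ≡aEᵢ → ¬aEᵢ≡bEᵢ (i , sym bEᵢ≡aEᵢ))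

lemma10p5 : (k : ℕ) → 2 ≤ k → ∀ {n m} (M₁ : Matroid n) (N : Matroid m) →
    HasMinorIso M₁ (copies k N) →
    (M₂ : Matroid n) → IsElementaryLift M₂ M₁ →
    HasMinorIso M₂ (copies (k ∸ 1) N)
lemma10p5 (suc (suc k)) (s≤s (s≤s z≤n)) M₁ N (C₁ , φ , φ-injective , φ∉C₁ , kN≅M₁/C₁)
          M₂ (M , e , M₁≅M/e , M₂≅M\e) =
  elementaryLift-hasMinorIso {K = suc k} N M e {M₁} {M₂} M₁≅M/e M₂≅M\e C₁ φ φ-injective φ∉C₁ kN≅M₁/C₁
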